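{- Let $x,y\in{}^\omega(\omega\setminus\{0\})$ be strictly increasing with $1\ll x\ll y$, and let $T$ be a $y$-squeezed tree. Then $T$ is an $x$-squeezed tree.
   Context: For $x,y\in{}^\omega(\omega\setminus\{0\})$: $x\ll y$ iff $x(n)\le y(n)$ for all $n$ and $\lim_{n\to\infty} y(n)/x(n)=\infty$; $1\ll x$ means $x$ diverges to infinity. Trees are subsets of ${}^{<\omega}\omega$ closed under initial segments. For $x\in{}^\omega(\omega\setminus\{0\})$ strictly increasing and $n\in\omega$, $(j,k,m)$ is an $x$-bound system above $n$ iff $k\in\omega$, $j,m$ are functions from $\{0,\dots,k\}$ into $\omega$, $j(0)>x(n+m(0)+1)$, and for all $l<k$, $j(l+1)>x(j(l)+m(l+1)+1)$. A tree $T$ is $(j,k,m,\eta)$-squeezed iff $T$ has no terminal nodes, $\mathrm{dom}(\eta)=\{(l,t): l\le k,\ t\le m(l)\}$, $\eta(l,t)\in{}^{j(l)}\omega$ for all $(l,t)\in\mathrm{dom}(\eta)$, and every $\nu\in T$ is comparable (one is an initial segment of the other) with $\eta(l,t)$ for some $(l,t)\in\mathrm{dom}(\eta)$. $T$ is $x$-squeezed iff for every $n\in\omega$ there is an $x$-bound system $(j,k,m)$ above $n$ and some $\eta$ such that $T$ is $(j,k,m,\eta)$-squeezed. -}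

module Defs where

open import Data.Nat using (ℕ; zero; suc; _+_; _*_; _≤_; _<_)
open import Data.List using (List; []; _∷_; _++_; [_]; length)
open import Data.Product using (Σ; ∃; ∃-syntax; _×_; _,_)
open import Data.Sum using (_⊎_)
open import Relation.Binary.PropositionalEquality using (_≡_)

-- Elements of ^ω(ω∖{0}) are represented as functions ℕ → ℕ with all values ≥ 1.
Positive : (ℕ → ℕ) → Set
Positive x = ∀ n → 1 ≤ x n

StrictlyIncreasing : (ℕ → ℕ) → Set
StrictlyIncreasing x = ∀ m n → m < n → x m < x n

-- 1 ≪ x : x diverges to infinity.
Diverges : (ℕ → ℕ) → Set
Diverges x = ∀ M → ∃[ N ] (∀ n → N ≤ n → M ≤ x n)

-- x ≪ y : x(n) ≤ y(n) for all n, and y(n)/x(n) → ∞.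
-- (With x(n) ≥ 1, "y(n)/x(n) ≥ M" is "M * x(n) ≤ y(n)".)
_≪_ : (ℕ → ℕ) → (ℕ → ℕ) → Set
x ≪ y = (∀ n → x n ≤ y n) × (∀ M → ∃[ N ] (∀ n → N ≤ n → M * x n ≤ y n))

_⊑_ : List ℕ → List ℕ → Set
ν ⊑ μ = ∃[ ρ ] (ν ++ ρ ≡ μ)

Comparable : List ℕ → List ℕ → Set
Comparable ν μ = (ν ⊑ μ) ⊎ (μ ⊑ ν)

IsTree : (List ℕ → Set) → Set
IsTree T = ∀ ν μ → ν ⊑ μ → T μ → T ν

NoTerminalNodes : (List ℕ → Set) → Set
NoTerminalNodes T = ∀ ν → T ν → ∃[ i ] T (ν ++ [ i ])

-- (j,k,m) is an x-bound system above n.  The functions j, m on {0,…,k}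
-- are represented as functions ℕ → ℕ of which only the values at l ≤ k matter.
BoundSystem : (x : ℕ → ℕ) (n : ℕ) (j : ℕ → ℕ) (k : ℕ) (m : ℕ → ℕ) → Set
BoundSystem x n j k m =
  (x (n + m 0 + 1) < j 0) ×
  (∀ l → l < k → x (j l + m (suc l) + 1) < j (suc l))

-- T is (j,k,m,η)-squeezed; η is defined on {(l,t) : l ≤ k, t ≤ m(l)}
-- (represented as a function ℕ → ℕ → List ℕ, only values on that domain matter).
Squeezed : (T : List ℕ → Set) (j : ℕ → ℕ) (k : ℕ) (m : ℕ → ℕ)
           (η : ℕ → ℕ → List ℕ) → Set
Squeezed T j k m η =
  NoTerminalNodes T ×
  (∀ l t → l ≤ k → t ≤ m l → length (η l t) ≡ j l) ×
  (∀ ν → T ν → ∃[ l ] ∃[ t ] (l ≤ k × t ≤ m l × Comparable ν (η l t)))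

XSqueezed : (x : ℕ → ℕ) (T : List ℕ → Set) → Set
XSqueezed x T =
  ∀ n → ∃[ j ] ∃[ k ] ∃[ m ] (BoundSystem x n j k m × ∃[ η ] Squeezed T j k m η)

-- A y-bound system is an x-bound system whenever x ≤ y pointwise, since every
-- condition has the form "bounding function at some point < j(l)"; the squeezing
-- data (j, k, m, η) can therefore be reused unchanged.
module Submission where

open import Defs
open import Data.Nat using (ℕ; _≤_)
open import Data.List using (List)
open import Data.Nat.Properties using (≤-<-trans)
open import Data.Product using (_,_; proj₁)

BoundSystem-antimono : ∀ {x y} → (∀ i → x i ≤ y i) →
                       ∀ n j k m → BoundSystem y n j k m → BoundSystem x n j k m
BoundSystem-antimono x≤y n j k m (first , step) =
  ≤-<-trans (x≤y _) first , λ l l<k → ≤-<-trans (x≤y _) (step l l<k)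

XSqueezed-antimono : ∀ {x y T} → (∀ i → x i ≤ y i) → XSqueezed y T → XSqueezed x T
XSqueezed-antimono x≤y sq n with sq n
... | j , k , m , bound , squeezed =
  j , k , m , BoundSystem-antimono x≤y n j k m bound , squeezed

lemma7p4 : (x y : ℕ → ℕ) → Positive x → Positive y →
    StrictlyIncreasing x → StrictlyIncreasing y →
    Diverges x → x ≪ y →
    (T : List ℕ → Set) → IsTree T → XSqueezed y T → XSqueezed x T
lemma7p4 x y _ _ _ _ _ x≪y T _ = XSqueezed-antimono (proj₁ x≪y)
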